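{- Let $\mathbf{A}$, $\mathbf{X}$ and $\mathbf{B}$ be finite forests of finite rooted trees. Then $\mathbf{A}\mathbf{X}=\mathbf{B}$ if and only if $\mathcal{R}(\mathbf{A})\,\mathcal{R}(\mathbf{X})=\mathcal{R}(\mathbf{B})$.
   Context: Rooted trees are in-trees; the depth of a node is its distance to the root. The product of rooted trees $\mathbf{t}_1=(V_1,E_1)$, $\mathbf{t}_2=(V_2,E_2)$ has vertex set $\{(v,u)\in V_1\times V_2\mid\mathrm{depth}(v)=\mathrm{depth}(u)\}$ and arcs $((v,u),(v',u'))$ whenever $(v,v')\in E_1$, $(u,u')\in E_2$. A forest is a multiset of rooted trees up to isomorphism; the product of forests is the multiset of all pairwise products. For a forest $\mathbf{F}$, $\mathcal{R}(\mathbf{F})$ is the tree obtained by adding a new root and making the roots of all trees of $\mathbf{F}$ its children (predecessors). Equality means isomorphism. -}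

module Defs where

open import Data.Nat using (ℕ; zero; suc)
open import Data.Fin using (Fin)
open import Data.List using (List; length; lookup; map; concatMap)
open import Data.Product using (Σ; _×_; _,_; proj₁; proj₂)
open import Relation.Binary.PropositionalEquality using (_≡_)
open import Function.Bundles using (_↔_; Inverse)

-- Finite rooted trees: a node with a (finite) list of subtrees.
-- The order of the list is irrelevant: all comparisons below are up to
-- digraph isomorphism.
data Tree : Set where
  node : List Tree → Tree

-- A forest is a finite multiset of rooted trees (order ignored, see _≈ₘ_).
Forest : Set
Forest = List Tree

data Pos : Tree → Set where
  root : ∀ {t} → Pos t
  sub  : ∀ {ts} (i : Fin (length ts)) → Pos (lookup ts i) → Pos (node ts)

depth : ∀ {t} → Pos t → ℕ
depth root      = zero
depth (sub i p) = suc (depth p)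

-- Arcs of the in-tree: from a vertex to its parent.
data Arc : {t : Tree} → Pos t → Pos t → Set where
  top  : ∀ {ts} {i : Fin (length ts)} → Arc {node ts} (sub i root) root
  step : ∀ {ts} {i : Fin (length ts)} {p q : Pos (lookup ts i)} →
         Arc p q → Arc {node ts} (sub i p) (sub i q)

record Digraph : Set₁ where
  field
    V : Set
    E : V → V → Set
open Digraph public

treeGraph : Tree → Digraph
treeGraph t = record { V = Pos t ; E = Arc }

_⊗_ : Tree → Tree → Digraph
t₁ ⊗ t₂ = record
  { V = Σ (Pos t₁ × Pos t₂) (λ vu → depth (proj₁ vu) ≡ depth (proj₂ vu))
  ; E = λ x y → Arc (proj₁ (proj₁ x)) (proj₁ (proj₁ y))
              × Arc (proj₂ (proj₁ x)) (proj₂ (proj₁ y))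
  }

_≅_ : Digraph → Digraph → Set
G ≅ H = Σ (V G ↔ V H) λ f →
  ∀ x y → (E G x y → E H (Inverse.to f x) (Inverse.to f y))
        × (E H (Inverse.to f x) (Inverse.to f y) → E G x y)

_≈ₘ_ : List Digraph → List Digraph → Set
L ≈ₘ M = Σ (Fin (length L) ↔ Fin (length M)) λ π →
  ∀ i → lookup L i ≅ lookup M (Inverse.to π i)

_⊛_ : Forest → Forest → List Digraph
A ⊛ X = concatMap (λ a → map (a ⊗_) X) A

forestGraph : Forest → List Digraph
forestGraph = map treeGraph

ℛ : Forest → Tree
ℛ F = node F

-- Both ℛ A ⊗ ℛ X and ℛ B are cones: an apex with a family of rooted graphs
-- hanging below it (the products a ⊗ x of the trees of A and X, resp. the
-- trees of B).  An isomorphism of cones fixes the apex, the unique sink, and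
-- maps each hanging graph into a single hanging graph, since every vertex is
-- joined to the sink of its own graph; so it is a bijection of the index sets
-- together with isomorphisms of the hanging graphs, and conversely.  It remains
-- to identify the multisets A ⊛ X and B with these indexed families.
module Submission where

open import Defs
open import Data.Nat using (ℕ; zero; suc)
open import Data.Nat.Properties using (suc-injective; 0≢1+n; ≡-irrelevant)
open import Data.Fin using (Fin; zero; suc; cast; splitAt)
open import Data.Fin.Properties using (cast-involutive; cast-is-id; +↔⊎)
open import Data.List using (List; []; _∷_; length; lookup; map; _++_)
open import Data.List.Properties using (length-map; length-++)
open import Data.Product using (∃; ∃₂; _×_; _,_; proj₁; proj₂; uncurry)
open import Data.Sum using (_⊎_; inj₁; inj₂; [_,_])
open import Data.Sum.Properties using ([,]-map)
open import Data.Sum.Function.Propositional using (_⊎-cong_)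
open import Data.Empty using (⊥-elim)
open import Function using (_∘_; _⇔_; _↔_; Inverse; mk⇔; mk↔ₛ′)
open import Function.Properties.Inverse using (↔-refl; ↔-trans; ↔-sym)
open import Function.Related.Propositional using (module EquationalReasoning)
open import Relation.Nullary using (¬_)
open import Relation.Binary.PropositionalEquality hiding (J; [_])

private
  variable
    G G′ H H′ K : Digraph
    I I′ J J′ L : Set

infix 4 _≃_ _≡ᶠ_ _≃ᶠ_

record _≃_ (G H : Digraph) : Set where
  field
    to       : V G → V H
    from     : V H → V G
    to-from  : ∀ y → to (from y) ≡ y
    from-to  : ∀ x → from (to x) ≡ x
    to-arc   : ∀ {x y} → E G x y → E H (to x) (to y)
    from-arc : ∀ {x y} → E H x y → E G (from x) (from y)
open _≃_ public

≃-refl : G ≃ G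
≃-refl = record
  { to = λ x → x ; from = λ x → x ; to-from = λ _ → refl ; from-to = λ _ → refl
  ; to-arc = λ e → e ; from-arc = λ e → e }

≃-sym : G ≃ H → H ≃ G
≃-sym f = record
  { to = from f ; from = to f ; to-from = from-to f ; from-to = to-from f
  ; to-arc = from-arc f ; from-arc = to-arc f }

≃-trans : G ≃ H → H ≃ K → G ≃ K
≃-trans f g = record
  { to       = to g ∘ to f
  ; from     = from f ∘ from g
  ; to-from  = λ z → trans (cong (to g) (to-from f _)) (to-from g z)
  ; from-to  = λ x → trans (cong (from f) (from-to g _)) (from-to f x)
  ; to-arc   = to-arc g ∘ to-arc f
  ; from-arc = from-arc f ∘ from-arc g
  }

≡⇒≃ : G ≡ H → G ≃ H
≡⇒≃ refl = ≃-refl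

reflect-arc : (f : G ≃ H) → ∀ {x y} → E H (to f x) (to f y) → E G x y
reflect-arc {G = G} f e = subst₂ (E G) (from-to f _) (from-to f _) (from-arc f e)

≃⇒≅ : G ≃ H → G ≅ H
≃⇒≅ f = mk↔ₛ′ (to f) (from f) (to-from f) (from-to f) , λ _ _ → to-arc f , reflect-arc f

≅⇒≃ : G ≅ H → G ≃ H
≅⇒≃ {H = H} (π , arcs) = record
  { to       = Inverse.to π
  ; from     = Inverse.from π
  ; to-from  = Inverse.strictlyInverseˡ π
  ; from-to  = Inverse.strictlyInverseʳ π
  ; to-arc   = proj₁ (arcs _ _)
  ; from-arc = λ e → proj₂ (arcs _ _)
      (subst₂ (E H) (sym (Inverse.strictlyInverseˡ π _)) (sym (Inverse.strictlyInverseˡ π _)) e)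
  }

≃⇔≅ : G ≃ H ⇔ G ≅ H
≃⇔≅ = mk⇔ ≃⇒≅ ≅⇒≃

≃-resp-≃ : G ≃ G′ → H ≃ H′ → G ≃ H ⇔ G′ ≃ H′
≃-resp-≃ g h = mk⇔ (λ f → ≃-trans (≃-sym g) (≃-trans f h))
                   (λ f → ≃-trans g (≃-trans f (≃-sym h)))

sink-preserved : (f : G ≃ H) {r : V G} {r′ : V H} →
                 (∀ {w} → ¬ E G r w) → (∀ v → v ≡ r′ ⊎ ∃ (E H v)) →
                 to f r ≡ r′
sink-preserved {H = H} f {r} r-sink r′-or-arc with r′-or-arc (to f r)
... | inj₁ eq      = eq
... | inj₂ (w , e) =
  ⊥-elim (r-sink (reflect-arc f (subst (E H (to f r)) (sym (to-from f w)) e)))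

-- Families indexed by arbitrary sets, equal or isomorphic up to reindexing

record _≡ᶠ_ {ℓ} {A : Set ℓ} (P : I → A) (Q : J → A) : Set ℓ where
  constructor _,_
  field
    bijection : I ↔ J
    pointwise : ∀ i → P i ≡ Q (Inverse.to bijection i)

module _ {ℓ} {A : Set ℓ} where

  ≗⇒≡ᶠ : {P Q : I → A} → (∀ i → P i ≡ Q i) → P ≡ᶠ Q
  ≗⇒≡ᶠ P≗Q = ↔-refl , P≗Q

  ≡ᶠ-trans : {P : I → A} {Q : J → A} {R : L → A} → P ≡ᶠ Q → Q ≡ᶠ R → P ≡ᶠ R
  ≡ᶠ-trans (π , P≡Q) (ρ , Q≡R) = ↔-trans π ρ , λ i → trans (P≡Q i) (Q≡R _)

  _⊎-≡ᶠ_ : {P : I → A} {Q : J → A} {P′ : I′ → A} {Q′ : J′ → A} →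
           P ≡ᶠ Q → P′ ≡ᶠ Q′ → [ P , P′ ] ≡ᶠ [ Q , Q′ ]
  (π , P≡Q) ⊎-≡ᶠ (ρ , P′≡Q′) = (π ⊎-cong ρ) , λ { (inj₁ i) → P≡Q i ; (inj₂ i) → P′≡Q′ i }

  cast-≡ᶠ : ∀ {m n} (eq : m ≡ n) (P : Fin n → A) → (P ∘ cast eq) ≡ᶠ P
  cast-≡ᶠ eq P = mk↔ₛ′ (cast eq) (cast (sym eq)) (cast-involutive eq (sym eq))
                       (cast-involutive (sym eq) eq)
               , λ _ → refl

  splitAt-≡ᶠ : ∀ m {n} (P : Fin m ⊎ Fin n → A) → (P ∘ splitAt m) ≡ᶠ P
  splitAt-≡ᶠ m P = +↔⊎ , λ _ → refl

  suc-×-≡ᶠ : ∀ {n} (P : Fin (suc n) × J → A) →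
             [ (λ j → P (zero , j)) , (λ { (i , j) → P (suc i , j) }) ] ≡ᶠ P
  suc-×-≡ᶠ {n = n} P = mk↔ₛ′ split join split-join join-split , λ { (inj₁ _) → refl ; (inj₂ _) → refl }
    where
    split : J ⊎ (Fin n × J) → Fin (suc n) × J
    split (inj₁ j)       = zero , j
    split (inj₂ (i , j)) = suc i , j
    join : Fin (suc n) × J → J ⊎ (Fin n × J)
    join (zero , j)  = inj₁ j
    join (suc i , j) = inj₂ (i , j)
    split-join : ∀ x → split (join x) ≡ x
    split-join (zero , j)  = refl
    split-join (suc i , j) = refl
    join-split : ∀ x → join (split x) ≡ x
    join-split (inj₁ j)       = refl
    join-split (inj₂ (i , j)) = refl

module _ {a b} {A : Set a} {B : Set b} (f : A → B) where

  lookup-map-cast : ∀ xs k → lookup (map f xs) k ≡ f (lookup xs (cast (length-map f xs) k))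
  lookup-map-cast (x ∷ xs) zero    = refl
  lookup-map-cast (x ∷ xs) (suc k) = lookup-map-cast xs k

  lookup-map-≡ᶠ : ∀ xs → lookup (map f xs) ≡ᶠ (f ∘ lookup xs)
  lookup-map-≡ᶠ xs =
    ≡ᶠ-trans (≗⇒≡ᶠ (lookup-map-cast xs)) (cast-≡ᶠ (length-map f xs) (f ∘ lookup xs))

module _ {a} {A : Set a} where

  lookup-++-splitAt : ∀ (xs ys : List A) k →
    lookup (xs ++ ys) k ≡ [ lookup xs , lookup ys ] (splitAt (length xs) (cast (length-++ xs) k))
  lookup-++-splitAt []       ys k       = cong (lookup ys) (sym (cast-is-id _ k))
  lookup-++-splitAt (x ∷ xs) ys zero    = refl
  lookup-++-splitAt (x ∷ xs) ys (suc k) =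
    trans (lookup-++-splitAt xs ys k) (sym ([,]-map (splitAt (length xs) _)))

  lookup-++-≡ᶠ : ∀ (xs ys : List A) → lookup (xs ++ ys) ≡ᶠ [ lookup xs , lookup ys ]
  lookup-++-≡ᶠ xs ys =
    ≡ᶠ-trans (≗⇒≡ᶠ (lookup-++-splitAt xs ys))
    (≡ᶠ-trans (cast-≡ᶠ (length-++ xs) _) (splitAt-≡ᶠ (length xs) [ lookup xs , lookup ys ]))

lookup-⊛-≡ᶠ : ∀ A X → lookup (A ⊛ X) ≡ᶠ uncurry (λ i j → lookup A i ⊗ lookup X j)
lookup-⊛-≡ᶠ []      X = mk↔ₛ′ (λ ()) (λ { (() , _) }) (λ { (() , _) }) (λ ()) , λ ()
lookup-⊛-≡ᶠ (a ∷ A) X =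
  ≡ᶠ-trans (lookup-++-≡ᶠ (map (a ⊗_) X) (A ⊛ X))
  (≡ᶠ-trans (lookup-map-≡ᶠ (a ⊗_) X ⊎-≡ᶠ lookup-⊛-≡ᶠ A X)
            (suc-×-≡ᶠ (uncurry (λ i j → lookup (a ∷ A) i ⊗ lookup X j))))

record _≃ᶠ_ (P : I → Digraph) (Q : J → Digraph) : Set where
  constructor _,_
  field
    bijection : I ↔ J
    pointwise : ∀ i → P i ≃ Q (Inverse.to bijection i)

≈ₘ⇔≃ᶠ : ∀ L M → L ≈ₘ M ⇔ lookup L ≃ᶠ lookup M
≈ₘ⇔≃ᶠ _ _ = mk⇔ (λ (π , φ) → π , λ i → ≅⇒≃ (φ i)) (λ (π , ψ) → π , λ i → ≃⇒≅ (ψ i))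

module _ {P : I → Digraph} {Q : J → Digraph} where

  ≡ᶠ⇒≃ᶠ : P ≡ᶠ Q → P ≃ᶠ Q
  ≡ᶠ⇒≃ᶠ (π , P≡Q) = π , λ i → ≡⇒≃ (P≡Q i)

  ≃ᶠ-sym : P ≃ᶠ Q → Q ≃ᶠ P
  ≃ᶠ-sym (π , ψ) = ↔-sym π , λ j →
    ≃-trans (≡⇒≃ (cong Q (sym (Inverse.strictlyInverseˡ π j)))) (≃-sym (ψ _))

  ≃ᶠ-trans : {R : L → Digraph} → P ≃ᶠ Q → Q ≃ᶠ R → P ≃ᶠ R
  ≃ᶠ-trans (π , ψ) (ρ , χ) = ↔-trans π ρ , λ i → ≃-trans (ψ i) (χ _)

≃ᶠ-resp-≡ᶠ : {P : I → Digraph} {P′ : I′ → Digraph} {Q : J → Digraph} {Q′ : J′ → Digraph} →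
             P ≡ᶠ P′ → Q ≡ᶠ Q′ → P ≃ᶠ Q ⇔ P′ ≃ᶠ Q′
≃ᶠ-resp-≡ᶠ P≡ᶠP′ Q≡ᶠQ′ =
  mk⇔ (λ P≃ᶠQ → ≃ᶠ-trans (≃ᶠ-sym (≡ᶠ⇒≃ᶠ P≡ᶠP′)) (≃ᶠ-trans P≃ᶠQ (≡ᶠ⇒≃ᶠ Q≡ᶠQ′)))
      (λ P′≃ᶠQ′ → ≃ᶠ-trans (≡ᶠ⇒≃ᶠ P≡ᶠP′) (≃ᶠ-trans P′≃ᶠQ′ (≃ᶠ-sym (≡ᶠ⇒≃ᶠ Q≡ᶠQ′))))

-- Cones over families of rooted graphs

record RootedGraph : Set₁ where
  field
    graph       : Digraph
    sink        : V graph
    sink-no-arc : ∀ {w} → ¬ E graph sink w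
    sink-or-arc : ∀ v → v ≡ sink ⊎ ∃ (E graph v)
    height      : V graph → ℕ
    height-arc  : ∀ {v w} → E graph v w → height v ≡ suc (height w)
open RootedGraph public

Vertex : RootedGraph → Set
Vertex P = V (graph P)

data ConeVertex (P : I → RootedGraph) : Set where
  apex : ConeVertex P
  inn  : (i : I) → Vertex (P i) → ConeVertex P

data ConeArc (P : I → RootedGraph) : ConeVertex P → ConeVertex P → Set where
  up     : ∀ {i} → ConeArc P (inn i (sink (P i))) apex
  inside : ∀ {i v w} → E (graph (P i)) v w → ConeArc P (inn i v) (inn i w)

Cone : (I → RootedGraph) → Digraph
Cone P = record { V = ConeVertex P ; E = ConeArc P }

module _ {P : I → RootedGraph} where

  apex-no-arc : ∀ {c} → ¬ ConeArc P apex c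
  apex-no-arc ()

  apex-or-arc : ∀ c → c ≡ apex ⊎ ∃ (ConeArc P c)
  apex-or-arc apex      = inj₁ refl
  apex-or-arc (inn i v) with sink-or-arc (P i) v
  ... | inj₁ refl    = inj₂ (apex , up)
  ... | inj₂ (w , e) = inj₂ (inn i w , inside e)

  inn-injectiveˡ : ∀ {i j v w} → inn {P = P} i v ≡ inn j w → i ≡ j
  inn-injectiveˡ refl = refl

  inn-injectiveʳ : ∀ {i v w} → inn {P = P} i v ≡ inn i w → v ≡ w
  inn-injectiveʳ refl = refl

  inside-injective : ∀ {i v w} → ConeArc P (inn i v) (inn i w) → E (graph (P i)) v w
  inside-injective (inside e) = e

  arc-into-inn : ∀ {c j w} → ConeArc P c (inn j w) → ∃ λ u → c ≡ inn j u
  arc-into-inn (inside e) = _ , refl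

cone-map : {P Q : I → RootedGraph} → (∀ i → graph (P i) ≃ graph (Q i)) → Cone P ≃ Cone Q
cone-map {P = P} {Q} ψ = record
  { to = map-with ψ ; from = map-with (≃-sym ∘ ψ)
  ; to-from = to-from′ ; from-to = from-to′
  ; to-arc = arc-with ψ ; from-arc = arc-with (≃-sym ∘ ψ) }
  where
  map-with : ∀ {P Q} → (∀ i → graph (P i) ≃ graph (Q i)) → ConeVertex P → ConeVertex Q
  map-with ψ apex      = apex
  map-with ψ (inn i v) = inn i (to (ψ i) v)

  arc-with : ∀ {P Q} (ψ : ∀ i → graph (P i) ≃ graph (Q i)) {x y} →
             ConeArc P x y → ConeArc Q (map-with ψ x) (map-with ψ y)
  arc-with {P} {Q} ψ (up {i})
    rewrite sink-preserved (ψ i) (sink-no-arc (P i)) (sink-or-arc (Q i)) = up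
  arc-with ψ (inside e) = inside (to-arc (ψ _) e)

  to-from′ : ∀ y → map-with ψ (map-with (≃-sym ∘ ψ) y) ≡ y
  to-from′ apex      = refl
  to-from′ (inn i v) = cong (inn i) (to-from (ψ i) v)

  from-to′ : ∀ x → map-with (≃-sym ∘ ψ) (map-with ψ x) ≡ x
  from-to′ apex      = refl
  from-to′ (inn i v) = cong (inn i) (from-to (ψ i) v)

cone-reindex : (π : I ↔ J) (Q : J → RootedGraph) → Cone (Q ∘ Inverse.to π) ≃ Cone Q
cone-reindex π Q = record
  { to = to′ ; from = from′ ; to-from = to-from′ ; from-to = from-to′
  ; to-arc = to-arc′ ; from-arc = from-arc′ }
  where
  open Inverse π using ()
    renaming (to to s; from to t; strictlyInverseˡ to s∘t; strictlyInverseʳ to t∘s)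

  transport : ∀ {j j′} → j′ ≡ j → Vertex (Q j) → Vertex (Q j′)
  transport p = subst (Vertex ∘ Q) (sym p)

  to′ : ConeVertex (Q ∘ s) → ConeVertex Q
  to′ apex      = apex
  to′ (inn i v) = inn (s i) v

  from′ : ConeVertex Q → ConeVertex (Q ∘ s)
  from′ apex      = apex
  from′ (inn j w) = inn (t j) (transport (s∘t j) w)

  inn-transport : ∀ {j j′} (p : j′ ≡ j) w → inn {P = Q} j′ (transport p w) ≡ inn j w
  inn-transport refl w = refl

  inn-transport-s : ∀ {i k} (p : k ≡ i) (q : s k ≡ s i) v →
                    inn {P = Q ∘ s} k (transport q v) ≡ inn i v
  inn-transport-s refl refl v = refl

  transport-sink : ∀ {j j′} (p : j′ ≡ j) → transport p (sink (Q j)) ≡ sink (Q j′)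
  transport-sink refl = refl

  transport-arc : ∀ {j j′} (p : j′ ≡ j) {v w} → E (graph (Q j)) v w →
                  E (graph (Q j′)) (transport p v) (transport p w)
  transport-arc refl e = e

  to-from′ : ∀ y → to′ (from′ y) ≡ y
  to-from′ apex      = refl
  to-from′ (inn j w) = inn-transport (s∘t j) w

  from-to′ : ∀ x → from′ (to′ x) ≡ x
  from-to′ apex      = refl
  from-to′ (inn i v) = inn-transport-s (t∘s i) (s∘t (s i)) v

  to-arc′ : ∀ {x y} → ConeArc (Q ∘ s) x y → ConeArc Q (to′ x) (to′ y)
  to-arc′ up         = up
  to-arc′ (inside e) = inside e

  from-arc′ : ∀ {x y} → ConeArc Q x y → ConeArc (Q ∘ s) (from′ x) (from′ y)
  from-arc′ (up {j})       rewrite transport-sink (s∘t j) = up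
  from-arc′ (inside {j} e) = inside (transport-arc (s∘t j) e)

module Components {P : I → RootedGraph} {Q : J → RootedGraph} (h : Cone P ≃ Cone Q) where

  inn-image : ∀ i v → ∃₂ λ j w → to h (inn i v) ≡ inn j w
  inn-image i v with to h (inn i v) in eq
  ... | inn j w = j , w , refl
  ... | apex    = ⊥-elim (inn≢apex (begin
    inn i v                 ≡⟨ from-to h (inn i v) ⟨
    from h (to h (inn i v)) ≡⟨ cong (from h) eq ⟩
    from h apex             ≡⟨ sink-preserved (≃-sym h) apex-no-arc apex-or-arc ⟩
    apex                    ∎))
    where
    open ≡-Reasoning
    inn≢apex : ¬ inn {P = P} i v ≡ apex
    inn≢apex ()

  index : I → J
  index i = proj₁ (inn-image i (sink (P i)))

  -- The image of the arc from v to its parent ends, by induction on the height,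
  -- in the component of index i, hence so does it start.
  component : ∀ i v → ∃ λ w → to h (inn i v) ≡ inn (index i) w
  component i v = go (height (P i) v) v refl
    where
    go : ∀ n v → height (P i) v ≡ n → ∃ λ w → to h (inn i v) ≡ inn (index i) w
    go n v hv with sink-or-arc (P i) v
    go n       v hv | inj₁ refl    = proj₂ (inn-image i (sink (P i)))
    go zero    v hv | inj₂ (w , e) = ⊥-elim (0≢1+n (trans (sym hv) (height-arc (P i) e)))
    go (suc n) v hv | inj₂ (w , e) =
      let u , hw≡u = go n w (suc-injective (trans (sym (height-arc (P i) e)) hv))
      in arc-into-inn (subst (ConeArc Q (to h (inn i v))) hw≡u (to-arc h (inside e)))

open Components using (index; component)

index-inverse : {P : I → RootedGraph} {Q : J → RootedGraph} (h : Cone P ≃ Cone Q) →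
                ∀ i → index (≃-sym h) (index h i) ≡ i
index-inverse {P = P} {Q} h i = inn-injectiveˡ (begin
  inn (index (≃-sym h) (index h i)) _ ≡⟨ proj₂ (component (≃-sym h) (index h i) w) ⟨
  from h (inn (index h i) w)          ≡⟨ cong (from h) hr≡w ⟨
  from h (to h (inn i (sink (P i))))  ≡⟨ from-to h _ ⟩
  inn i (sink (P i))                  ∎)
  where
  open ≡-Reasoning
  w : Vertex (Q (index h i))
  w = proj₁ (component h i (sink (P i)))
  hr≡w : to h (inn i (sink (P i))) ≡ inn (index h i) w
  hr≡w = proj₂ (component h i (sink (P i)))

cone-≃⇒≃ᶠ : {P : I → RootedGraph} {Q : J → RootedGraph} →
            Cone P ≃ Cone Q → (graph ∘ P) ≃ᶠ (graph ∘ Q)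
cone-≃⇒≃ᶠ {I = I} {J = J} {P = P} {Q} h = mk↔ₛ′ s t (index-inverse (≃-sym h)) (index-inverse h) , ψ
  where
  s : I → J
  s = index h
  t : J → I
  t = index (≃-sym h)

  ψ : ∀ i → graph (P i) ≃ graph (Q (s i))
  ψ i = record
    { to       = λ v → proj₁ (image v)
    ; from     = λ w → proj₁ (preimage w)
    ; to-from  = λ w → inn-injectiveʳ (begin
        inn (s i) (proj₁ (image (proj₁ (preimage w)))) ≡⟨ proj₂ (image _) ⟨
        to h (inn i (proj₁ (preimage w)))             ≡⟨ cong (to h) (proj₂ (preimage w)) ⟨
        to h (from h (inn (s i) w))                   ≡⟨ to-from h _ ⟩
        inn (s i) w                                   ∎)
    ; from-to  = λ v → inn-injectiveʳ (begin
        inn i (proj₁ (preimage (proj₁ (image v)))) ≡⟨ proj₂ (preimage _) ⟨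
        from h (inn (s i) (proj₁ (image v)))       ≡⟨ cong (from h) (proj₂ (image v)) ⟨
        from h (to h (inn i v))                    ≡⟨ from-to h _ ⟩
        inn i v                                    ∎)
    ; to-arc   = λ e → inside-injective
        (subst₂ (ConeArc Q) (proj₂ (image _)) (proj₂ (image _)) (to-arc h (inside e)))
    ; from-arc = λ e → inside-injective
        (subst₂ (ConeArc P) (proj₂ (preimage _)) (proj₂ (preimage _)) (from-arc h (inside e)))
    }
    where
    open ≡-Reasoning
    image : ∀ v → ∃ λ w → to h (inn i v) ≡ inn (s i) w
    image = component h i
    preimage : ∀ w → ∃ λ v → from h (inn (s i) w) ≡ inn i v
    preimage w = subst (λ k → ∃ λ v → from h (inn (s i) w) ≡ inn k v)
                       (index-inverse h i) (component (≃-sym h) (s i) w)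

≃ᶠ⇔cone-≃ : {P : I → RootedGraph} {Q : J → RootedGraph} →
            (graph ∘ P) ≃ᶠ (graph ∘ Q) ⇔ Cone P ≃ Cone Q
≃ᶠ⇔cone-≃ {Q = Q} = mk⇔ (λ (π , ψ) → ≃-trans (cone-map ψ) (cone-reindex π Q)) cone-≃⇒≃ᶠ

-- Trees and products of trees as rooted graphs

root-or-arc : ∀ {t} (p : Pos t) → p ≡ root ⊎ ∃ (Arc p)
root-or-arc root = inj₁ refl
root-or-arc (sub i p) with root-or-arc p
... | inj₁ refl    = inj₂ (root , top)
... | inj₂ (q , e) = inj₂ (sub i q , step e)

depth-arc : ∀ {t} {p q : Pos t} → Arc p q → depth p ≡ suc (depth q)
depth-arc top      = refl
depth-arc (step e) = cong suc (depth-arc e)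

root-no-arc : ∀ {t} {q : Pos t} → ¬ Arc root q
root-no-arc ()

treeRooted : Tree → RootedGraph
treeRooted t = record
  { graph = treeGraph t ; sink = root ; sink-no-arc = root-no-arc ; sink-or-arc = root-or-arc
  ; height = depth ; height-arc = depth-arc }

productRooted : Tree → Tree → RootedGraph
productRooted a x = record
  { graph       = a ⊗ x
  ; sink        = (root , root) , refl
  ; sink-no-arc = root-no-arc ∘ proj₁
  ; sink-or-arc = sink-or-arc′
  ; height      = depth ∘ proj₁ ∘ proj₁
  ; height-arc  = depth-arc ∘ proj₁
  }
  where
  sink-or-arc′ : ∀ v → v ≡ ((root , root) , refl) ⊎ ∃ (E (a ⊗ x) v)
  sink-or-arc′ ((p , q) , d) with root-or-arc p | root-or-arc q
  ... | inj₁ refl     | inj₁ refl      = inj₁ (cong ((root , root) ,_) (≡-irrelevant d refl))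
  ... | inj₁ refl     | inj₂ (q′ , e′) = ⊥-elim (0≢1+n (trans d (depth-arc e′)))
  ... | inj₂ (p′ , e) | inj₁ refl      = ⊥-elim (0≢1+n (trans (sym d) (depth-arc e)))
  ... | inj₂ (p′ , e) | inj₂ (q′ , e′) =
    inj₂ (((p′ , q′) , suc-injective (trans (sym (depth-arc e)) (trans d (depth-arc e′)))) , e , e′)

productFamily : (A X : Forest) → Fin (length A) × Fin (length X) → RootedGraph
productFamily A X = uncurry (λ i j → productRooted (lookup A i) (lookup X j))

ℛ⊗ℛ≃cone : ∀ A X → ℛ A ⊗ ℛ X ≃ Cone (productFamily A X)
ℛ⊗ℛ≃cone A X = record
  { to = to′ ; from = from′ ; to-from = to-from′ ; from-to = from-to′
  ; to-arc = to-arc′ ; from-arc = from-arc′ }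
  where
  to′ : V (ℛ A ⊗ ℛ X) → ConeVertex (productFamily A X)
  to′ ((root    , root)    , d) = apex
  to′ ((sub i p , sub j q) , d) = inn (i , j) ((p , q) , suc-injective d)

  from′ : ConeVertex (productFamily A X) → V (ℛ A ⊗ ℛ X)
  from′ apex                        = (root , root) , refl
  from′ (inn (i , j) ((p , q) , d)) = (sub i p , sub j q) , cong suc d

  to-from′ : ∀ y → to′ (from′ y) ≡ y
  to-from′ apex                        = refl
  to-from′ (inn (i , j) ((p , q) , d)) = cong (λ d → inn (i , j) ((p , q) , d)) (≡-irrelevant _ d)

  from-to′ : ∀ x → from′ (to′ x) ≡ x
  from-to′ ((root    , root)    , d) = cong ((root , root) ,_) (≡-irrelevant refl d)
  from-to′ ((sub i p , sub j q) , d) = cong ((sub i p , sub j q) ,_) (≡-irrelevant _ d)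

  to-arc′ : ∀ {x y} → E (ℛ A ⊗ ℛ X) x y → ConeArc (productFamily A X) (to′ x) (to′ y)
  to-arc′ {(_ , _) , refl} {(_ , _) , refl} (top , top) = up
  to-arc′ {_} {_ , ()} (top    , step _)
  to-arc′ {_} {_ , ()} (step _ , top)
  to-arc′ (step e , step e′)                            = inside (e , e′)

  from-arc′ : ∀ {x y} → ConeArc (productFamily A X) x y → E (ℛ A ⊗ ℛ X) (from′ x) (from′ y)
  from-arc′ up                = top , top
  from-arc′ (inside (e , e′)) = step e , step e′

ℛ≃cone : ∀ B → treeGraph (ℛ B) ≃ Cone (treeRooted ∘ lookup B)
ℛ≃cone B = record
  { to = to′ ; from = from′ ; to-from = to-from′ ; from-to = from-to′
  ; to-arc = to-arc′ ; from-arc = from-arc′ }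
  where
  to′ : Pos (ℛ B) → ConeVertex (treeRooted ∘ lookup B)
  to′ root      = apex
  to′ (sub k p) = inn k p

  from′ : ConeVertex (treeRooted ∘ lookup B) → Pos (ℛ B)
  from′ apex      = root
  from′ (inn k p) = sub k p

  to-from′ : ∀ y → to′ (from′ y) ≡ y
  to-from′ apex      = refl
  to-from′ (inn k p) = refl

  from-to′ : ∀ x → from′ (to′ x) ≡ x
  from-to′ root      = refl
  from-to′ (sub k p) = refl

  to-arc′ : ∀ {x y} → Arc x y → ConeArc (treeRooted ∘ lookup B) (to′ x) (to′ y)
  to-arc′ top      = up
  to-arc′ (step e) = inside e

  from-arc′ : ∀ {x y} → ConeArc (treeRooted ∘ lookup B) x y → Arc (from′ x) (from′ y)
  from-arc′ up         = top
  from-arc′ (inside e) = step e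

lemma1 : (A X B : Forest) →
    ((A ⊛ X) ≈ₘ forestGraph B) ⇔ ((ℛ A ⊗ ℛ X) ≅ treeGraph (ℛ B))
lemma1 A X B = begin
  ((A ⊛ X) ≈ₘ forestGraph B)
    ∼⟨ ≈ₘ⇔≃ᶠ (A ⊛ X) (forestGraph B) ⟩
  (lookup (A ⊛ X) ≃ᶠ lookup (forestGraph B))
    ∼⟨ ≃ᶠ-resp-≡ᶠ (lookup-⊛-≡ᶠ A X) (lookup-map-≡ᶠ treeGraph B) ⟩
  (graph ∘ productFamily A X ≃ᶠ graph ∘ treeRooted ∘ lookup B)
    ∼⟨ ≃ᶠ⇔cone-≃ ⟩
  (Cone (productFamily A X) ≃ Cone (treeRooted ∘ lookup B))
    ∼⟨ ≃-resp-≃ (≃-sym (ℛ⊗ℛ≃cone A X)) (≃-sym (ℛ≃cone B)) ⟩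
  (ℛ A ⊗ ℛ X ≃ treeGraph (ℛ B))
    ∼⟨ ≃⇔≅ ⟩
  ((ℛ A ⊗ ℛ X) ≅ treeGraph (ℛ B))
    ∎
  where open EquationalReasoning
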